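{- Let $G$ be a connected simple graph with $n$ vertices and let $T=T(v_0,v_1,\dots,v_s)$ be a greedy spanning tree of $G$. Let $n_1$ be the length of the orbit of $v_0$ under the action of the automorphism group of $G$. Then $$\mathrm{aut}(G)\leq n_1\,(d(v_0))!\prod_{i=1}^s (d_T(v_i)-1)!.$$ In particular, for any greedy spanning tree $T=T(v_0,v_1,\dots,v_s)$ of $G$, $$\mathrm{aut}(G)\leq n\,(d(v_0))!\prod_{v\in V(G)}(d_T(v)-1)!.$$
   Context: $\mathrm{aut}(G)$ is the order of the automorphism group of $G$; $d(v)$ is the degree of $v$ in $G$ and $d_T(v)$ the degree of $v$ in the tree $T$. A greedy spanning tree $T(v_0,v_1,\dots,v_s)$ of a connected graph $G$ is constructed as follows. Choose any vertex $v_0$ and let $T_0$ be the star consisting of $v_0$, all its neighbours, and all edges of $G$ incident to $v_0$. Given the tree $T_{i-1}$, choose a leaf $v_i$ of $T_{i-1}$ that has at least one incident edge $v_iw$ in $G$ with $w\notin V(T_{i-1})$, and let $T_i$ be obtained from $T_{i-1}$ by adding all edges $v_iw$ of $G$ with $w\notin V(T_{i-1})$ (together with these vertices $w$). The construction stops at step $s$ when no leaf $v$ of $T_s$ has an incident edge of $G$ whose other endpoint lies outside $V(T_s)$; the resulting tree $T=T_s$ is a spanning tree of $G$, called a greedy spanning tree and denoted $T(v_0,v_1,\dots,v_s)$. -}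

module Defs where

open import Data.Bool using (Bool; true; false; _∧_; _∨_; not)
open import Data.Nat using (ℕ; zero; suc; _∸_; _*_)
open import Data.Fin using (Fin) renaming (_≟_ to _≟ᶠ_)
open import Data.Fin.Properties using (all?)
open import Data.List using (List; []; _∷_; length; filter; filterᵇ; map; concatMap; foldl; allFin; [_])
open import Data.List.Relation.Unary.Any using (Any; any?)
open import Data.Vec.Functional using () renaming (_∷_ to _∷ᶠ_)
open import Data.Product using (Σ; ∃; _×_; _,_)
open import Relation.Binary.PropositionalEquality using (_≡_)
open import Relation.Nullary using (Dec; yes; no; ¬_)
open import Relation.Nullary.Decidable using (_×-dec_; _→-dec_; map′; ⌊_⌋)
open import Data.Bool.Properties using () renaming (_≟_ to _≟ᵇ_)
open import Function.Definitions using (Injective)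

allMaps : (m k : ℕ) → List (Fin m → Fin k)
allMaps zero    k = [ (λ ()) ]
allMaps (suc m) k = concatMap (λ i → map (λ f → i ∷ᶠ f) (allMaps m k)) (allFin k)

_==_ : ∀ {n} → Fin n → Fin n → Bool
a == b = ⌊ a ≟ᶠ b ⌋

record Graph (n : ℕ) : Set where
  field
    adj    : Fin n → Fin n → Bool
    sym    : ∀ u v → adj u v ≡ adj v u
    irrefl : ∀ v → adj v v ≡ false
open Graph public

module _ {n : ℕ} (G : Graph n) where

  data Walk : Fin n → Fin n → Set where
    [] : ∀ {v} → Walk v v
    _∷_ : ∀ {u w v} → adj G u w ≡ true → Walk w v → Walk u v

  Connected : Set
  Connected = ∀ u v → Walk u v

  deg : Fin n → ℕ
  deg v = length (filterᵇ (adj G v) (allFin n))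

  -- automorphisms: bijections Fin n → Fin n preserving adjacency
  -- (an injective self-map of the finite set Fin n is a bijection)
  IsAutomorphism : (Fin n → Fin n) → Set
  IsAutomorphism f = Injective _≡_ _≡_ f × (∀ u v → adj G (f u) (f v) ≡ adj G u v)

  isAutomorphism? : ∀ f → Dec (IsAutomorphism f)
  isAutomorphism? f =
    map′ (λ h {x} {y} → h x y) (λ h x y → h {x} {y})
         (all? λ u → all? λ v → (f u ≟ᶠ f v) →-dec (u ≟ᶠ v))
    ×-dec
    (all? λ u → all? λ v → adj G (f u) (f v) ≟ᵇ adj G u v)

  automorphisms : List (Fin n → Fin n)
  automorphisms = filter isAutomorphism? (allMaps n n)

  aut : ℕ
  aut = length automorphisms

  orbitLength : Fin n → ℕ
  orbitLength v = length (filter (λ w → any? (λ f → f v ≟ᶠ w) automorphisms) (allFin n))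

  record Tree : Set where
    field
      inV  : Fin n → Bool
      edge : Fin n → Fin n → Bool
  open Tree public

  degT : Tree → Fin n → ℕ
  degT t v = length (filterᵇ (edge t v) (allFin n))

  star : Fin n → Tree
  star v0 = record
    { inV  = λ w → (w == v0) ∨ adj G v0 w
    ; edge = λ a b → ((a == v0) ∧ adj G a b) ∨ ((b == v0) ∧ adj G a b) }

  grow : Tree → Fin n → Tree
  grow t x = record
    { inV  = λ w → inV t w ∨ adj G x w
    ; edge = λ a b → edge t a b
                   ∨ ((a == x) ∧ (adj G x b ∧ not (inV t b)))
                   ∨ ((b == x) ∧ (adj G x a ∧ not (inV t a))) }

  IsLeaf : Tree → Fin n → Set
  IsLeaf t x = degT t x ≡ 1

  Extendable : Tree → Fin n → Set
  Extendable t x = ∃ λ w → adj G x w ≡ true × inV t w ≡ false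

  GreedyFrom : Tree → List (Fin n) → Set
  GreedyFrom t []       = ∀ x → IsLeaf t x → ¬ Extendable t x
  GreedyFrom t (x ∷ xs) = IsLeaf t x × Extendable t x × GreedyFrom (grow t x) xs

  IsGreedy : Fin n → List (Fin n) → Set
  IsGreedy v0 vs = GreedyFrom (star v0) vs

  greedyTree : Fin n → List (Fin n) → Tree
  greedyTree v0 vs = foldl grow (star v0) vs

module Submission where

-- An automorphism of the connected graph G is determined by its restriction to V(T) = V(G), and we
-- count these restrictions along the greedy construction. There are at most n₁ restrictions to {v₀}.
-- Once the restriction to V(T_{i-1}) is fixed, the automorphism must map the k neighbours of v_i outside
-- V(T_{i-1}) bijectively onto the neighbours of the image of v_i outside the image of V(T_{i-1}), so at
-- most k! extensions to V(T_i) remain; k = d(v₀) for the star T₀, and k ≤ d_T(v_i) − 1 for i ≥ 1 since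
-- v_i was a leaf of T_{i-1}. The second bound follows because n₁ ≤ n and the v_i are distinct.

open import Algebra.Properties.CommutativeSemigroup using (x∙yz≈y∙xz)
open import Data.Bool using (Bool; true; false; T; not; _∧_; _∨_)
open import Data.Bool.Properties using (T-∨; T-∧; T-≡)
open import Data.Fin using (Fin; zero; suc; _≟_; punchOut)
open import Data.Fin.Properties using (any?; all?; pigeonhole; punchOut-injective; <⇒≢)
open import Data.List using (List; []; _∷_; [_]; length; map; filter; allFin; foldl)
open import Data.List.Membership.Propositional using (_∈_)
open import Data.List.Membership.Propositional.Properties
  using (∈-filter⁺; ∈-filter⁻; ∈-map⁺; ∈-map⁻; ∈-allFin)
open import Data.List.Properties
  using (length-map; length-removeAt; length-removeAt′; length-filter; length-tabulate; filter-≐)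
open import Data.List.Relation.Binary.Subset.Propositional using (_⊆_)
import Data.List.Relation.Binary.Sublist.Propositional as Sublist
import Data.List.Relation.Binary.Sublist.Propositional.Properties as Sublist
open import Data.List.Relation.Unary.All as All using (All; []; _∷_)
import Data.List.Relation.Unary.All.Properties as All
open import Data.List.Relation.Unary.AllPairs as AllPairs using (AllPairs; []; _∷_)
import Data.List.Relation.Unary.AllPairs.Properties as AllPairs
open import Data.List.Relation.Unary.Any as Any using (here; there; _─_)
open import Data.List.Relation.Unary.Unique.Propositional using (Unique)
import Data.List.Relation.Unary.Unique.Propositional.Properties as Unique
open import Data.Nat using (ℕ; zero; suc; _+_; _*_; _∸_; _≤_; _<_; _!; pred; z≤n; s≤s; s≤s⁻¹)
open import Data.Nat.Divisibility using (m≤n⇒m!∣n!; ∣⇒≤)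
open import Data.Nat.ListAction using (product)
open import Data.Nat.Properties
  using ( ≤-refl; ≤-trans; ≤-reflexive; ≤-antisym; module ≤-Reasoning; n<1+n; +-suc; +-mono-≤
        ; *-assoc; *-identityʳ; *-mono-≤; *-monoˡ-≤; *-monoʳ-≤; ∸-monoˡ-≤; 1≤n!; _!≢0
        ; *-commutativeSemigroup)
open import Data.Product using (∃; _×_; _,_; proj₁; proj₂)
open import Data.Sum using (_⊎_; inj₁; inj₂; [_,_]′)
import Data.Sum as Sum
open import Data.Vec.Functional using () renaming (_∷_ to _∷ᶠ_)
open import Defs hiding (sym; irrefl)
open import Function using (_∘_; id)
open import Function.Bundles using (Equivalence)
open import Function.Definitions using (Injective)
open import Relation.Binary using (Decidable; DecidableEquality)
open import Relation.Binary.PropositionalEquality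
  using (_≡_; _≢_; refl; sym; trans; cong; cong₂; subst; module ≡-Reasoning)
open import Relation.Nullary using (¬_; yes; no; contradiction; ¬?)
open import Relation.Nullary.Decidable using (T?; toWitness; fromWitness; _×-dec_; _→-dec_)
import Relation.Unary as U
open import Relation.Unary.Properties using (∁?)

open Equivalence using (to; from)

module _ {A : Set} where

  ∈-─ : ∀ {x y : A} {ys} (y∈ys : y ∈ ys) → x ∈ ys → x ≢ y → x ∈ (ys ─ y∈ys)
  ∈-─ (here refl)  (here refl)  x≢y = contradiction refl x≢y
  ∈-─ (here refl)  (there x∈ys) _   = x∈ys
  ∈-─ (there _)    (here refl)  _   = here refl
  ∈-─ (there y∈ys) (there x∈ys) x≢y = there (∈-─ y∈ys x∈ys x≢y)

  ⊆-─ : ∀ {x : A} {xs ys} → All (x ≢_) xs → (x∈ys : x ∈ ys) → xs ⊆ ys → xs ⊆ (ys ─ x∈ys)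
  ⊆-─ x∉xs x∈ys xs⊆ys z∈xs = ∈-─ x∈ys (xs⊆ys z∈xs) (λ z≡x → All.lookup x∉xs z∈xs (sym z≡x))

  length-≤-⊆ : ∀ {xs ys : List A} → Unique xs → xs ⊆ ys → length xs ≤ length ys
  length-≤-⊆ [] _ = z≤n
  length-≤-⊆ {x ∷ xs} {ys} (x∉xs ∷ xs!) xs⊆ys = begin
    suc (length xs)          ≤⟨ s≤s (length-≤-⊆ xs! xs⊆ys─x) ⟩
    suc (length (ys ─ x∈ys)) ≡⟨ length-removeAt′ ys _ ⟨
    length ys                ∎
    where
    open ≤-Reasoning
    x∈ys = xs⊆ys (here refl)
    xs⊆ys─x = ⊆-─ x∉xs x∈ys (xs⊆ys ∘ there)

  product-─ : (f : A → ℕ) {y : A} {ys : List A} (y∈ys : y ∈ ys) →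
              product (map f ys) ≡ f y * product (map f (ys ─ y∈ys))
  product-─ f (here refl) = refl
  product-─ f {y} {z ∷ ys} (there y∈ys) = begin
    f z * product (map f ys)                   ≡⟨ cong (f z *_) (product-─ f y∈ys) ⟩
    f z * (f y * product (map f (ys ─ y∈ys))) ≡⟨ x∙yz≈y∙xz *-commutativeSemigroup (f z) (f y) _ ⟩
    f y * (f z * product (map f (ys ─ y∈ys))) ∎
    where open ≡-Reasoning

  1≤product : (f : A → ℕ) → (∀ x → 1 ≤ f x) → ∀ xs → 1 ≤ product (map f xs)
  1≤product f pos []       = ≤-refl
  1≤product f pos (x ∷ xs) = *-mono-≤ (pos x) (1≤product f pos xs)

  product-≤-⊆ : (f : A → ℕ) → (∀ x → 1 ≤ f x) → ∀ {xs ys} → Unique xs → xs ⊆ ys →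
                product (map f xs) ≤ product (map f ys)
  product-≤-⊆ f pos {[]} {ys} _ _ = 1≤product f pos ys
  product-≤-⊆ f pos {x ∷ xs} {ys} (x∉xs ∷ xs!) xs⊆ys = begin
    f x * product (map f xs)          ≤⟨ *-monoʳ-≤ (f x) (product-≤-⊆ f pos xs! xs⊆ys─x) ⟩
    f x * product (map f (ys ─ x∈ys)) ≡⟨ product-─ f x∈ys ⟨
    product (map f ys)                ∎
    where
    open ≤-Reasoning
    x∈ys = xs⊆ys (here refl)
    xs⊆ys─x = ⊆-─ x∉xs x∈ys (xs⊆ys ∘ there)

  module _ {P : A → Set} (P? : U.Decidable P) where

    length-filter-∁ : ∀ xs → length xs ≡ length (filter P? xs) + length (filter (∁? P?) xs)
    length-filter-∁ [] = refl
    length-filter-∁ (x ∷ xs) with P? x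
    ... | yes _ = cong suc (length-filter-∁ xs)
    ... | no  _ = trans (cong suc (length-filter-∁ xs)) (sym (+-suc _ _))

    filter-nonempty : ∀ xs → 0 < length (filter P? xs) → ∃ P
    filter-nonempty (x ∷ xs) len>0 with P? x
    ... | yes px = x , px
    ... | no  _  = filter-nonempty xs len>0

    length-filter-mono : ∀ {Q : A → Set} (Q? : U.Decidable Q) → P U.⊆ Q → ∀ xs →
                         length (filter P? xs) ≤ length (filter Q? xs)
    length-filter-mono Q? P⊆Q xs =
      Sublist.length-mono-≤ (Sublist.filter⁺ P? Q? (λ { refl → P⊆Q }) (Sublist.⊆-refl {x = xs}))

!-mono-≤ : ∀ {m n} → m ≤ n → m ! ≤ n !
!-mono-≤ {n = n} m≤n = ∣⇒≤ {{n !≢0}} (m≤n⇒m!∣n! m≤n)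

n*pred[n]!≤n! : ∀ n → n * pred n ! ≤ n !
n*pred[n]!≤n! zero    = z≤n
n*pred[n]!≤n! (suc n) = ≤-refl

-- Counting pairwise distinguishable elements

module _ {A : Set} where

  Separated : (A → A → Set) → List A → Set
  Separated R = AllPairs (λ x y → ¬ R x y)

  -- For an equivalence R: P meets at most k classes.
  AtMost : (A → A → Set) → (A → Set) → ℕ → Set
  AtMost R P k = ∀ xs → All P xs → Separated R xs → length xs ≤ k

  AtMost-≤ : ∀ {R P k l} → k ≤ l → AtMost R P k → AtMost R P l
  AtMost-≤ k≤l atMost xs ps sep = ≤-trans (atMost xs ps sep) k≤l

  AtMost-⊆ : ∀ {R P Q k} → Q U.⊆ P → AtMost R P k → AtMost R Q k
  AtMost-⊆ Q⊆P atMost xs qs = atMost xs (All.map Q⊆P qs)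

  AtMost-⇒ : ∀ {R R′ P k} → (∀ {x y} → P x → P y → R′ x y → R x y) → AtMost R′ P k → AtMost R P k
  AtMost-⇒ {R} {R′} {P} R′⇒R atMost xs ps sep = atMost xs ps (separated ps sep)
    where
    separated : ∀ {xs} → All P xs → Separated R xs → Separated R′ xs
    separated []        []          = []
    separated (px ∷ ps) (x≁xs ∷ sep) =
      All.zipWith (λ (py , x≁y) → x≁y ∘ R′⇒R px py) (ps , x≁xs) ∷ separated ps sep

  -- Induction on a: split off the R₀-fibre of the head x; the others avoid its class,
  -- so they meet one class fewer.
  AtMost-fibred : ∀ {R₀ R₁ P a b} → Decidable R₀ → AtMost R₀ P a →
                  (∀ r → P r → AtMost R₁ (λ x → P x × R₀ r x) b) → AtMost R₁ P (a * b)
  AtMost-fibred R₀? classes fibres [] _ _ = z≤n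
  AtMost-fibred {a = zero} R₀? classes fibres (x ∷ _) (px ∷ _) _
    with () ← classes [ x ] (px ∷ []) ([] ∷ [])
  AtMost-fibred {R₀} {R₁} {P} {suc a} {b} R₀? classes fibres (x ∷ xs) ps@(px ∷ _) sep = begin
    length (x ∷ xs)                                 ≡⟨ length-filter-∁ (R₀? x) (x ∷ xs) ⟩
    length (filter (R₀? x) (x ∷ xs)) + length rest  ≤⟨ +-mono-≤ fibre-of-x others ⟩
    b + a * b                                       ∎
    where
    open ≤-Reasoning
    rest = filter (∁? (R₀? x)) (x ∷ xs)
    fibre-of-x = fibres x px _ (All.zip (All.filter⁺ (R₀? x) ps , All.all-filter (R₀? x) (x ∷ xs)))
                                (AllPairs.filter⁺ (R₀? x) sep)
    classes′ : AtMost R₀ (λ y → P y × ¬ R₀ x y) a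
    classes′ ys qs sep′ = s≤s⁻¹ (classes (x ∷ ys) (px ∷ All.map proj₁ qs) (All.map proj₂ qs ∷ sep′))
    fibres′ : ∀ r → P r × ¬ R₀ x r → AtMost R₁ (λ y → (P y × ¬ R₀ x y) × R₀ r y) b
    fibres′ r (pr , _) = AtMost-⊆ (λ ((py , _) , r~y) → py , r~y) (fibres r pr)
    others = AtMost-fibred R₀? classes′ fibres′ rest
               (All.zip (All.filter⁺ (∁? (R₀? x)) ps , All.all-filter (∁? (R₀? x)) (x ∷ xs)))
               (AllPairs.filter⁺ (∁? (R₀? x)) sep)

module _ {A B : Set} where

  AgreeOn : List A → (A → B) → (A → B) → Set
  AgreeOn C f g = ∀ {z} → z ∈ C → f z ≡ g z

  InjectsInto : List A → List B → (A → B) → Set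
  InjectsInto C E f = Unique (map f C) × map f C ⊆ E

  injections-AtMost : DecidableEquality B → ∀ C E → AtMost (AgreeOn C) (InjectsInto C E) (length E !)
  injections-AtMost _≟ᴮ_ [] E []          _ _ = z≤n
  injections-AtMost _≟ᴮ_ [] E (_ ∷ [])    _ _ = 1≤n! (length E)
  injections-AtMost _≟ᴮ_ [] E (_ ∷ _ ∷ _) _ ((f≉g ∷ _) ∷ _) = contradiction (λ ()) f≉g
  injections-AtMost _≟ᴮ_ (x ∷ C) E =
    AtMost-≤ (n*pred[n]!≤n! (length E)) (AtMost-fibred (λ f g → f x ≟ᴮ g x) values fibres)
    where
    values : AtMost (λ f g → f x ≡ g x) (InjectsInto (x ∷ C) E) (length E)
    values fs injs sep = begin
      length fs                    ≡⟨ length-map (λ f → f x) fs ⟨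
      length (map (λ f → f x) fs)  ≤⟨ length-≤-⊆ (AllPairs.map⁺ sep) values∈E ⟩
      length E                     ∎
      where
      open ≤-Reasoning
      values∈E : map (λ f → f x) fs ⊆ E
      values∈E y∈ with f , f∈fs , refl ← ∈-map⁻ (λ f → f x) y∈ = proj₂ (All.lookup injs f∈fs) (here refl)

    fibres : ∀ r → InjectsInto (x ∷ C) E r →
             AtMost (AgreeOn (x ∷ C)) (λ f → InjectsInto (x ∷ C) E f × r x ≡ f x) (pred (length E) !)
    fibres r (_ , rxC⊆E) =
      AtMost-⇒ extend (AtMost-⊆ shrink
        (AtMost-≤ (≤-reflexive (cong _! (length-removeAt E (Any.index rx∈E))))
          (injections-AtMost _≟ᴮ_ C (E ─ rx∈E))))
      where
      rx∈E = rxC⊆E (here refl)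
      shrink : ∀ {f} → InjectsInto (x ∷ C) E f × r x ≡ f x → InjectsInto C (E ─ rx∈E) f
      shrink {f} (((fx∉fC ∷ fC!) , fxC⊆E) , rx≡fx) =
        fC! , ⊆-─ (subst (λ y → All (y ≢_) (map f C)) (sym rx≡fx) fx∉fC) rx∈E (fxC⊆E ∘ there)
      extend : ∀ {f g} → InjectsInto (x ∷ C) E f × r x ≡ f x → InjectsInto (x ∷ C) E g × r x ≡ g x →
               AgreeOn C f g → AgreeOn (x ∷ C) f g
      extend (_ , rx≡fx) (_ , rx≡gx) f≈g (here refl)  = trans (sym rx≡fx) rx≡gx
      extend _           _           f≈g (there z∈C) = f≈g z∈C

injective⇒surjective : ∀ {n} {f : Fin n → Fin n} → Injective _≡_ _≡_ f → ∀ y → ∃ λ x → f x ≡ y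
injective⇒surjective {suc n} {f} f-inj y with any? (λ x → f x ≟ y)
... | yes hit = hit
... | no miss =
  let i , j , i<j , fi≈fj = pigeonhole (n<1+n n) (λ x → punchOut {i = y} (miss ∘ (x ,_) ∘ sym))
  in contradiction (f-inj (punchOut-injective {i = y} _ _ fi≈fj)) (<⇒≢ i<j)

allMaps-distinct : ∀ m k → AllPairs (λ f g → ¬ (∀ i → f i ≡ g i)) (allMaps m k)
allMaps-distinct zero    k = [] ∷ []
allMaps-distinct (suc m) k =
  AllPairs.concat⁺ (All.map⁺ (All.tabulate λ _ → within)) (AllPairs.map⁺ (AllPairs.map across (Unique.allFin⁺ k)))
  where
  within : ∀ {i} → AllPairs (λ f g → ¬ (∀ j → f j ≡ g j)) (map (i ∷ᶠ_) (allMaps m k))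
  within = AllPairs.map⁺ (AllPairs.map (λ f≉g f≈g → f≉g (f≈g ∘ suc)) (allMaps-distinct m k))
  across : ∀ {i j} → i ≢ j → All (λ f → All (λ g → ¬ (∀ l → f l ≡ g l)) (map (j ∷ᶠ_) (allMaps m k)))
                                 (map (i ∷ᶠ_) (allMaps m k))
  across i≢j = All.map⁺ (All.tabulate λ _ → All.map⁺ (All.tabulate λ _ f≈g → i≢j (f≈g zero)))

module _ {n : ℕ} where

  ==⇒≡ : ∀ {a b : Fin n} → T (a == b) → a ≡ b
  ==⇒≡ {a} {b} = toWitness {a? = a ≟ b}

  ≡⇒== : ∀ {a b : Fin n} → a ≡ b → T (a == b)
  ≡⇒== {a} {b} = fromWitness {a? = a ≟ b}

  length-filter-≡1 : ∀ {P : Fin n → Set} (P? : U.Decidable P) {v} → P v → (∀ {x} → P x → x ≡ v) →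
                     length (filter P? (allFin n)) ≡ 1
  length-filter-≡1 P? {v} Pv only-v = ≤-antisym
    (length-≤-⊆ {ys = [ v ]} (Unique.filter⁺ P? (Unique.allFin⁺ n))
                (λ x∈ → here (only-v (proj₂ (∈-filter⁻ P? {xs = allFin n} x∈)))))
    (length-≤-⊆ {xs = [ v ]} ([] ∷ []) λ { (here refl) → ∈-filter⁺ P? (∈-allFin v) Pv })

T-∧-not⁻ : ∀ c d e → T (c ∧ (d ∧ not e)) → T c × T d × ¬ T e
T-∧-not⁻ true true false _ = _ , _ , λ ()

T-∧-not⁺ : ∀ c d e → T c → T d → ¬ T e → T (c ∧ (d ∧ not e))
T-∧-not⁺ true true false _ _ _  = _
T-∧-not⁺ true true true  _ _ ¬e = ¬e _

-- Restrictions of automorphisms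

module _ {n : ℕ} (G : Graph n) where

  adj-sym : ∀ {u v} → T (adj G u v) → T (adj G v u)
  adj-sym {u} {v} = subst T (Graph.sym G u v)

  adj-irrefl : ∀ {v} → ¬ T (adj G v v)
  adj-irrefl {v} = subst T (Graph.irrefl G v)

  Agree : (Fin n → Bool) → (Fin n → Fin n) → (Fin n → Fin n) → Set
  Agree S f g = ∀ x → T (S x) → f x ≡ g x

  agree? : ∀ S → Decidable (Agree S)
  agree? S f g = all? λ x → T? (S x) →-dec (f x ≟ g x)

  RestrictionsAtMost : (Fin n → Bool) → ℕ → Set
  RestrictionsAtMost S = AtMost (Agree S) (_∈ automorphisms G)

  ∈automorphisms⇒IsAutomorphism : ∀ {f} → f ∈ automorphisms G → IsAutomorphism G f
  ∈automorphisms⇒IsAutomorphism = proj₂ ∘ ∈-filter⁻ (isAutomorphism? G) {xs = allMaps n n}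

  aut≤ : ∀ {S k} → (∀ x → T (S x)) → RestrictionsAtMost S k → aut G ≤ k
  aut≤ everywhere atMost = atMost (automorphisms G) (All.tabulate id)
    (AllPairs.map (λ f≉g f≈g → f≉g (λ x → f≈g x (everywhere x)))
                  (AllPairs.filter⁺ (isAutomorphism? G) (allMaps-distinct n n)))

  RestrictionsAtMost-orbit : ∀ v₀ → RestrictionsAtMost (_== v₀) (orbitLength G v₀)
  RestrictionsAtMost-orbit v₀ fs fs∈Aut sep = begin
    length fs                     ≡⟨ length-map (λ f → f v₀) fs ⟨
    length (map (λ f → f v₀) fs)  ≤⟨ length-≤-⊆ (AllPairs.map⁺ (AllPairs.map differ-at-v₀ sep)) in-orbit ⟩
    orbitLength G v₀              ∎
    where
    open ≤-Reasoning
    differ-at-v₀ : ∀ {f g} → ¬ Agree (_== v₀) f g → f v₀ ≢ g v₀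
    differ-at-v₀ {f} {g} f≉g fv₀≡gv₀ = f≉g λ x x==v₀ → subst (λ y → f y ≡ g y) (sym (==⇒≡ x==v₀)) fv₀≡gv₀
    in-orbit : map (λ f → f v₀) fs ⊆ filter (λ w → Any.any? (λ f → f v₀ ≟ w) (automorphisms G)) (allFin n)
    in-orbit w∈ with f , f∈fs , refl ← ∈-map⁻ (λ f → f v₀) w∈ =
      ∈-filter⁺ _ (∈-allFin _) (Any.map (λ { refl → refl }) (All.lookup fs∈Aut f∈fs))

  orbitLength≤n : ∀ v → orbitLength G v ≤ n
  orbitLength≤n v = ≤-trans (length-filter _ (allFin n)) (≤-reflexive (length-tabulate id))

  newNeighbours : (Fin n → Bool) → Fin n → List (Fin n)
  newNeighbours S v = filter (λ w → T? (adj G v w) ×-dec ¬? (T? (S w))) (allFin n)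

  module _ {S : Fin n → Bool} {v : Fin n} where

    ∈-newNeighbours⁺ : ∀ {w} → T (adj G v w) → ¬ T (S w) → w ∈ newNeighbours S v
    ∈-newNeighbours⁺ {w} vw w∉S = ∈-filter⁺ _ (∈-allFin w) (vw , w∉S)

    ∈-newNeighbours⁻ : ∀ {w} → w ∈ newNeighbours S v → T (adj G v w) × ¬ T (S w)
    ∈-newNeighbours⁻ = proj₂ ∘ ∈-filter⁻ _ {xs = allFin n}

    -- f z is adjacent to f v = r v, so f z = r z′ with z′ adjacent to v (r is onto),
    -- and z′ ∉ S since otherwise f z′ = r z′ = f z.
    map-newNeighbours-⊆ : T (S v) → ∀ {r f} → IsAutomorphism G r → IsAutomorphism G f → Agree S r f →
                          map f (newNeighbours S v) ⊆ map r (newNeighbours S v)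
    map-newNeighbours-⊆ v∈S {r} {f} (r-inj , r-adj) (f-inj , f-adj) r≈f y∈
      with z , z∈C , refl ← ∈-map⁻ f y∈
      with z′ , rz′≡fz ← injective⇒surjective r-inj (f z) =
      subst (_∈ map r (newNeighbours S v)) rz′≡fz (∈-map⁺ r (∈-newNeighbours⁺ vz′ z′∉S))
      where
      open ≡-Reasoning
      vz = proj₁ (∈-newNeighbours⁻ z∈C)
      z∉S = proj₂ (∈-newNeighbours⁻ z∈C)
      vz′ : T (adj G v z′)
      vz′ = subst T (begin
        adj G v z          ≡⟨ f-adj v z ⟨
        adj G (f v) (f z)  ≡⟨ cong₂ (adj G) (r≈f v v∈S) rz′≡fz ⟨
        adj G (r v) (r z′) ≡⟨ r-adj v z′ ⟩
        adj G v z′         ∎) vz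
      z′∉S : ¬ T (S z′)
      z′∉S z′∈S = z∉S (subst (T ∘ S) (sym (f-inj (trans (sym rz′≡fz) (r≈f z′ z′∈S)))) z′∈S)

  RestrictionsAtMost-extend : ∀ {S v B} → T (S v) → RestrictionsAtMost S B →
    RestrictionsAtMost (λ w → S w ∨ adj G v w) (B * length (newNeighbours S v) !)
  RestrictionsAtMost-extend {S} {v} v∈S atMost = AtMost-fibred (agree? S) atMost fibre
    where
    C = newNeighbours S v
    fibre : ∀ r → r ∈ automorphisms G →
            AtMost (Agree (λ w → S w ∨ adj G v w)) (λ f → f ∈ automorphisms G × Agree S r f) (length C !)
    fibre r r∈Aut = AtMost-⇒ glue (AtMost-⊆ injects
      (AtMost-≤ (≤-reflexive (cong _! (length-map r C))) (injections-AtMost _≟_ C (map r C))))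
      where
      r-aut = ∈automorphisms⇒IsAutomorphism r∈Aut
      injects : ∀ {f} → f ∈ automorphisms G × Agree S r f → InjectsInto C (map r C) f
      injects (f∈Aut , r≈f) = let f-aut = ∈automorphisms⇒IsAutomorphism f∈Aut in
        Unique.map⁺ (proj₁ f-aut) (Unique.filter⁺ _ (Unique.allFin⁺ n)) ,
        map-newNeighbours-⊆ v∈S r-aut f-aut r≈f
      glue : ∀ {f g} → f ∈ automorphisms G × Agree S r f → g ∈ automorphisms G × Agree S r g →
             AgreeOn C f g → Agree (λ w → S w ∨ adj G v w) f g
      glue (_ , r≈f) (_ , r≈g) f≈g x x∈ with T? (S x)
      ... | yes x∈S = trans (sym (r≈f x x∈S)) (r≈g x x∈S)
      ... | no  x∉S = f≈g (∈-newNeighbours⁺ vx x∉S)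
        where vx = [ (λ x∈S → contradiction x∈S x∉S) , id ]′ (to T-∨ x∈)

  RestrictionsAtMost-star : ∀ v₀ → RestrictionsAtMost (inV (star G v₀)) (orbitLength G v₀ * deg G v₀ !)
  RestrictionsAtMost-star v₀ =
    subst (λ d → RestrictionsAtMost (inV (star G v₀)) (orbitLength G v₀ * d !)) all-new
      (RestrictionsAtMost-extend (≡⇒== refl) (RestrictionsAtMost-orbit v₀))
    where
    all-new : length (newNeighbours (_== v₀) v₀) ≡ deg G v₀
    all-new = cong length (filter-≐ _ (T? ∘ adj G v₀)
      (proj₁ , λ v₀w → v₀w , λ w==v₀ → adj-irrefl (subst (T ∘ adj G v₀) (==⇒≡ w==v₀) v₀w)) (allFin n))

  -- Greedy spanning trees

  EdgesInside : Tree G → Set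
  EdgesInside t = ∀ {a b} → T (edge t a b) → T (inV t a) × T (inV t b)

  Closed : Tree G → Fin n → Set
  Closed t x = ∀ {w} → T (adj G x w) → T (inV t w)

  -- Invariant of the construction: once no leaf is extendable, every tree vertex is closed,
  -- so the tree spans the connected graph G.
  LeafOrClosed : Tree G → Set
  LeafOrClosed t = ∀ {x} → T (inV t x) → Closed t x ⊎ IsLeaf G t x

  Closed⇒¬Extendable : ∀ {t x} → Closed t x → ¬ Extendable G t x
  Closed⇒¬Extendable closed (w , xw , w∉t) = subst T w∉t (closed (from T-≡ xw))

  ¬Extendable⇒Closed : ∀ {t x} → ¬ Extendable G t x → Closed t x
  ¬Extendable⇒Closed {t} {x} stuck {w} xw with inV t w in w∈t
  ... | true  = _
  ... | false = contradiction (w , to T-≡ xw , w∈t) stuck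

  leaf-inside : ∀ {t x} → EdgesInside t → IsLeaf G t x → T (inV t x)
  leaf-inside {t} {x} inside leaf =
    proj₁ (inside (proj₂ (filter-nonempty (T? ∘ edge t x) (allFin n) (≤-reflexive (sym leaf)))))

  star-edge⁻ : ∀ v₀ {a b} → T (edge (star G v₀) a b) → (a ≡ v₀ ⊎ b ≡ v₀) × T (adj G a b)
  star-edge⁻ v₀ ab with to T-∨ ab
  ... | inj₁ a-centre = let a==v₀ , ab′ = to T-∧ a-centre in inj₁ (==⇒≡ a==v₀) , ab′
  ... | inj₂ b-centre = let b==v₀ , ab′ = to T-∧ b-centre in inj₂ (==⇒≡ b==v₀) , ab′

  centre∈star : ∀ v₀ → T (inV (star G v₀) v₀)
  centre∈star v₀ = from (T-∨ {v₀ == v₀}) (inj₁ (≡⇒== refl))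

  adj⇒∈star : ∀ v₀ {w} → T (adj G v₀ w) → T (inV (star G v₀) w)
  adj⇒∈star v₀ {w} = from (T-∨ {w == v₀}) ∘ inj₂

  star-EdgesInside : ∀ v₀ → EdgesInside (star G v₀)
  star-EdgesInside v₀ {a} {b} ab with star-edge⁻ v₀ {a} {b} ab
  ... | inj₁ refl , ab = centre∈star v₀ , adj⇒∈star v₀ ab
  ... | inj₂ refl , ab = adj⇒∈star v₀ (adj-sym ab) , centre∈star v₀

  star-LeafOrClosed : ∀ v₀ → LeafOrClosed (star G v₀)
  star-LeafOrClosed v₀ {x} x∈star with to T-∨ x∈star
  ... | inj₁ x==v₀ with refl ← ==⇒≡ {a = x} {b = v₀} x==v₀ = inj₁ (adj⇒∈star v₀)
  ... | inj₂ v₀x = inj₂ (length-filter-≡1 (T? ∘ edge (star G v₀) x)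
        (from (T-∨ {(x == v₀) ∧ adj G x v₀}) (inj₂ (from T-∧ (≡⇒== refl , adj-sym v₀x))))
        (λ xb → [ (λ { refl → contradiction v₀x adj-irrefl }) , id ]′ (proj₁ (star-edge⁻ v₀ xb))))

  inV-grow⁺ : ∀ t x {w} → T (inV t w) → T (inV (grow G t x) w)
  inV-grow⁺ t x {w} = from (T-∨ {inV t w}) ∘ inj₁

  adj⇒inV-grow : ∀ t x {w} → T (adj G x w) → T (inV (grow G t x) w)
  adj⇒inV-grow t x {w} = from (T-∨ {inV t w}) ∘ inj₂

  Closed-grow : ∀ {t x} y → Closed t x → Closed (grow G t y) x
  Closed-grow {t} y closed = inV-grow⁺ t y ∘ closed

  edge-grow⁺ : ∀ t x {a b} → T (edge t a b) → T (edge (grow G t x) a b)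
  edge-grow⁺ t x {a} {b} = from (T-∨ {edge t a b}) ∘ inj₁

  grow-edge-out : ∀ t x {b} → T (adj G x b) → ¬ T (inV t b) → T (edge (grow G t x) x b)
  grow-edge-out t x {b} xb b∉t = from (T-∨ {edge t x b}) (inj₂ (from (T-∨ {(x == x) ∧ _})
    (inj₁ (T-∧-not⁺ (x == x) _ (inV t b) (≡⇒== refl) xb b∉t))))

  grow-edge-in : ∀ t x {a} → T (adj G x a) → ¬ T (inV t a) → T (edge (grow G t x) a x)
  grow-edge-in t x {a} xa a∉t = from (T-∨ {edge t a x}) (inj₂ (from (T-∨ {(a == x) ∧ _})
    (inj₂ (T-∧-not⁺ (x == x) _ (inV t a) (≡⇒== refl) xa a∉t))))

  grow-edge⁻ : ∀ t x {a b} → T (edge (grow G t x) a b) →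
               T (edge t a b) ⊎ (a ≡ x × T (adj G x b) × ¬ T (inV t b))
                              ⊎ (b ≡ x × T (adj G x a) × ¬ T (inV t a))
  grow-edge⁻ t x {a} {b} ab with to (T-∨ {edge t a b}) ab
  ... | inj₁ old = inj₁ old
  ... | inj₂ new with to (T-∨ {(a == x) ∧ _}) new
  ... | inj₁ out = let a==x , xb , b∉t = T-∧-not⁻ (a == x) _ _ out in inj₂ (inj₁ (==⇒≡ a==x , xb , b∉t))
  ... | inj₂ inn = let b==x , xa , a∉t = T-∧-not⁻ (b == x) _ _ inn in inj₂ (inj₂ (==⇒≡ b==x , xa , a∉t))

  grow-EdgesInside : ∀ {t x} → EdgesInside t → T (inV t x) → EdgesInside (grow G t x)
  grow-EdgesInside {t} {x} inside x∈t {a} {b} ab with grow-edge⁻ t x {a} {b} ab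
  ... | inj₁ old                    = inV-grow⁺ t x (proj₁ (inside old)) , inV-grow⁺ t x (proj₂ (inside old))
  ... | inj₂ (inj₁ (refl , xb , _)) = inV-grow⁺ t x x∈t , adj⇒inV-grow t x xb
  ... | inj₂ (inj₂ (refl , xa , _)) = adj⇒inV-grow t x xa , inV-grow⁺ t x x∈t

  degT-grow-old : ∀ {t x y} → y ≢ x → T (inV t y) → degT G (grow G t x) y ≡ degT G t y
  degT-grow-old {t} {x} {y} y≢x y∈t =
    cong length (filter-≐ (T? ∘ edge (grow G t x) y) (T? ∘ edge t y) (old , edge-grow⁺ t x) (allFin n))
    where
    old : ∀ {b} → T (edge (grow G t x) y b) → T (edge t y b)
    old yb with grow-edge⁻ t x yb
    ... | inj₁ yb′                    = yb′
    ... | inj₂ (inj₁ (y≡x , _))       = contradiction y≡x y≢x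
    ... | inj₂ (inj₂ (_ , _ , y∉t))   = contradiction y∈t y∉t

  grow-new-leaf : ∀ {t x y} → EdgesInside t → y ≢ x → ¬ T (inV t y) → T (adj G x y) → IsLeaf G (grow G t x) y
  grow-new-leaf {t} {x} {y} inside y≢x y∉t xy =
    length-filter-≡1 (T? ∘ edge (grow G t x) y) (grow-edge-in t x xy y∉t) only-x
    where
    only-x : ∀ {b} → T (edge (grow G t x) y b) → b ≡ x
    only-x yb with grow-edge⁻ t x yb
    ... | inj₁ old                  = contradiction (proj₁ (inside old)) y∉t
    ... | inj₂ (inj₁ (y≡x , _))     = contradiction y≡x y≢x
    ... | inj₂ (inj₂ (b≡x , _))     = b≡x

  grow-LeafOrClosed : ∀ {t x} → EdgesInside t → LeafOrClosed t → LeafOrClosed (grow G t x)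
  -- Deciding y ≟ x instead would abstract that term inside edge (grow G t x) y in the goal.
  grow-LeafOrClosed {t} {x} inside leafOrClosed {y} y∈ with x ≟ y
  ... | yes refl = inj₁ (adj⇒inV-grow t x)
  ... | no  x≢y with T? (inV t y)
  ... | yes y∈t =
    Sum.map (Closed-grow {t} x) (trans (degT-grow-old {t} (x≢y ∘ sym) y∈t)) (leafOrClosed y∈t)
  ... | no  y∉t = inj₂ (grow-new-leaf {t} inside (x≢y ∘ sym) y∉t xy)
    where xy = [ (λ y∈t → contradiction y∈t y∉t) , id ]′ (to (T-∨ {inV t y}) y∈)

  grow-degree : ∀ {t x} → EdgesInside t → IsLeaf G t x →
                suc (length (newNeighbours (inV t) x)) ≤ degT G (grow G t x) x
  grow-degree {t} {x} inside leaf =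
    length-≤-⊆ {xs = b₀ ∷ newNeighbours (inV t) x} (b₀∉new ∷ Unique.filter⁺ _ (Unique.allFin⁺ n)) edges
    where
    tree-neighbour = filter-nonempty (T? ∘ edge t x) (allFin n) (≤-reflexive (sym leaf))
    b₀ = proj₁ tree-neighbour
    xb₀ = proj₂ tree-neighbour
    b₀∉new : All (b₀ ≢_) (newNeighbours (inV t) x)
    b₀∉new = All.tabulate λ w∈ → λ { refl → proj₂ (∈-newNeighbours⁻ w∈) (proj₂ (inside xb₀)) }
    edges : b₀ ∷ newNeighbours (inV t) x ⊆ filter (T? ∘ edge (grow G t x) x) (allFin n)
    edges (here refl) = ∈-filter⁺ _ (∈-allFin b₀) (edge-grow⁺ t x xb₀)
    edges (there w∈)  = let xw , w∉t = ∈-newNeighbours⁻ w∈ in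
                        ∈-filter⁺ _ (∈-allFin _) (grow-edge-out t x xw w∉t)

  inV-foldl-grow : ∀ {t} vs {w} → T (inV t w) → T (inV (foldl (grow G) t vs) w)
  inV-foldl-grow          []       = id
  inV-foldl-grow {t} (v ∷ vs) = inV-foldl-grow vs ∘ inV-grow⁺ t v

  degT-foldl-grow : ∀ {t} vs x → degT G t x ≤ degT G (foldl (grow G) t vs) x
  degT-foldl-grow {t} vs x = length-filter-mono _ _ (edges vs) (allFin n)
    where
    edges : ∀ {t} vs {b} → T (edge t x b) → T (edge (foldl (grow G) t vs) x b)
    edges          []       = id
    edges {t} (v ∷ vs) = edges vs ∘ edge-grow⁺ t v

  greedy-closed : ∀ {t vs} → EdgesInside t → LeafOrClosed t → GreedyFrom G t vs →
                  ∀ {x} → T (inV (foldl (grow G) t vs) x) → Closed (foldl (grow G) t vs) x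
  greedy-closed {t} {[]} _ leafOrClosed stuck x∈ with leafOrClosed x∈
  ... | inj₁ closed = closed
  ... | inj₂ leaf   = ¬Extendable⇒Closed {t} (stuck _ leaf)
  greedy-closed {t} {v ∷ _} inside leafOrClosed (leaf , _ , greedy) =
    greedy-closed (grow-EdgesInside inside (leaf-inside inside leaf))
                  (grow-LeafOrClosed {t} inside leafOrClosed) greedy

  greedy-spanning : Connected G → ∀ {v₀ vs} → IsGreedy G v₀ vs → ∀ x → T (inV (greedyTree G v₀ vs) x)
  greedy-spanning connected {v₀} {vs} greedy x = reach (connected v₀ x) (inV-foldl-grow vs (centre∈star v₀))
    where
    closed = greedy-closed (star-EdgesInside v₀) (star-LeafOrClosed v₀) greedy
    reach : ∀ {u w} → Walk G u w → T (inV (greedyTree G v₀ vs) u) → T (inV (greedyTree G v₀ vs) w)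
    reach []          u∈ = u∈
    reach (uw ∷ walk) u∈ = reach walk (closed u∈ (from T-≡ uw))

  greedy-Unique : ∀ {t vs} → GreedyFrom G t vs → Unique vs
  greedy-Unique {vs = []} _ = []
  greedy-Unique {t} {v ∷ _} (_ , _ , greedy) = never-again (adj⇒inV-grow t v) greedy ∷ greedy-Unique greedy
    where
    never-again : ∀ {t vs} → Closed t v → GreedyFrom G t vs → All (v ≢_) vs
    never-again {vs = []} _ _ = []
    never-again {t} {w ∷ _} closed (_ , extendable , greedy) =
      (λ { refl → Closed⇒¬Extendable {t} closed extendable }) ∷ never-again (Closed-grow {t} w closed) greedy

  RestrictionsAtMost-greedy : ∀ {t vs B} → EdgesInside t → GreedyFrom G t vs → RestrictionsAtMost (inV t) B →
    let F = foldl (grow G) t vs in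
    RestrictionsAtMost (inV F) (B * product (map (λ v → (degT G F v ∸ 1) !) vs))
  RestrictionsAtMost-greedy {vs = []} {B} _ _ atMost = AtMost-≤ (≤-reflexive (sym (*-identityʳ B))) atMost
  RestrictionsAtMost-greedy {t} {v ∷ vs} {B} inside (leaf , _ , greedy) atMost =
    AtMost-≤ (≤-reflexive (*-assoc B _ _))
      (RestrictionsAtMost-greedy (grow-EdgesInside inside v∈t) greedy
        (AtMost-≤ (*-monoʳ-≤ B (!-mono-≤ new≤deg)) (RestrictionsAtMost-extend v∈t atMost)))
    where
    v∈t = leaf-inside inside leaf
    new≤deg : length (newNeighbours (inV t) v) ≤ degT G (foldl (grow G) (grow G t v) vs) v ∸ 1
    new≤deg = ∸-monoˡ-≤ 1 (≤-trans (grow-degree inside leaf) (degT-foldl-grow vs v))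

theorem3 : (n : ℕ) (G : Graph n) → Connected G →
           (v0 : Fin n) (vs : List (Fin n)) → IsGreedy G v0 vs →
           (aut G ≤ orbitLength G v0 * (deg G v0) !
                      * product (map (λ v → (degT G (greedyTree G v0 vs) v ∸ 1) !) vs))
           × (aut G ≤ n * (deg G v0) !
                      * product (map (λ v → (degT G (greedyTree G v0 vs) v ∸ 1) !) (allFin n)))
theorem3 n G connected v0 vs greedy = aut≤bound , ≤-trans aut≤bound coarser
  where
  d : Fin n → ℕ
  d v = degT G (greedyTree G v0 vs) v ∸ 1
  aut≤bound = aut≤ G (greedy-spanning G connected greedy)
    (RestrictionsAtMost-greedy G (star-EdgesInside G v0) greedy (RestrictionsAtMost-star G v0))
  coarser = *-mono-≤ (*-monoˡ-≤ (deg G v0 !) (orbitLength≤n G v0))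
                     (product-≤-⊆ (_! ∘ d) (1≤n! ∘ d) (greedy-Unique G greedy) (λ {v} _ → ∈-allFin v))
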